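{- Every non-trivial CMV-algebra (i.e. one with $0\neq 1$, where $1:=0^*$) has at least four elements.
   Context: An MV-algebra is a structure $\langle A,\oplus,{}^*,0\rangle$ of type $(2,1,0)$ satisfying: $(x\oplus y)\oplus z=x\oplus(y\oplus z)$, $x\oplus y=y\oplus x$, $x\oplus 0=x$, $(x^*)^*=x$, $x\oplus 0^*=0^*$, $(x^*\oplus y)^*\oplus y=(y^*\oplus x)^*\oplus x$. A CMV-algebra is a structure $\langle A,\oplus,{}^*,0,\diamond,i\rangle$ such that $\langle A,\oplus,{}^*,0\rangle$ is an MV-algebra, $\langle A,\diamond,i\rangle$ is a monoid, and for all $x,y,z\in A$: $(y\oplus z)\diamond x=(y\diamond x)\oplus(z\diamond x)$, $x^*\diamond y=(x\diamond y)^*$, and $0\diamond x=0$. -}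

module Defs where

open import Level using (Level; suc)
open import Relation.Binary.PropositionalEquality using (_≡_; _≢_)
open import Data.Product using (Σ; _×_; ∃-syntax)

record IsMVAlgebra {a : Level} (A : Set a) (_⊕_ : A → A → A) (_* : A → A) (𝟘 : A) : Set a where
  field
    ⊕-assoc   : ∀ x y z → (x ⊕ y) ⊕ z ≡ x ⊕ (y ⊕ z)
    ⊕-comm    : ∀ x y → x ⊕ y ≡ y ⊕ x
    ⊕-identity : ∀ x → x ⊕ 𝟘 ≡ x
    *-involutive : ∀ x → (x *) * ≡ x
    ⊕-absorb  : ∀ x → x ⊕ (𝟘 *) ≡ 𝟘 *
    łukasiewicz : ∀ x y → (((x *) ⊕ y) *) ⊕ y ≡ (((y *) ⊕ x) *) ⊕ x

record CMVAlgebra (a : Level) : Set (suc a) where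
  infixl 6 _⊕_
  infixl 7 _⋄_
  field
    Carrier : Set a
    _⊕_ : Carrier → Carrier → Carrier
    _*  : Carrier → Carrier
    𝟘   : Carrier
    _⋄_ : Carrier → Carrier → Carrier
    i   : Carrier
    isMV : IsMVAlgebra Carrier _⊕_ _* 𝟘
    ⋄-assoc : ∀ x y z → (x ⋄ y) ⋄ z ≡ x ⋄ (y ⋄ z)
    ⋄-identityˡ : ∀ x → i ⋄ x ≡ x
    ⋄-identityʳ : ∀ x → x ⋄ i ≡ x
    ⋄-distribʳ-⊕ : ∀ x y z → (y ⊕ z) ⋄ x ≡ (y ⋄ x) ⊕ (z ⋄ x)
    *-⋄ : ∀ x y → (x *) ⋄ y ≡ (x ⋄ y) *
    𝟘-⋄ : ∀ x → 𝟘 ⋄ x ≡ 𝟘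

  𝟙 : Carrier
  𝟙 = 𝟘 *

NonTrivial : {a : Level} → CMVAlgebra a → Set a
NonTrivial C = CMVAlgebra.𝟘 C ≢ CMVAlgebra.𝟙 C

AtLeastFourElements : {a : Level} → Set a → Set a
AtLeastFourElements A =
  Σ A λ w → Σ A λ x → Σ A λ y → Σ A λ z →
    (w ≢ x × w ≢ y × w ≢ z × x ≢ y × x ≢ z × y ≢ z)

module Submission where

-- Idea: right multiplication by a fixed element c is a function, so whenever
-- x ⋄ c and y ⋄ c differ, x and y differ.  The four candidates are told apart
-- by their "values" at 𝟘 and at 𝟙:
--
--        x   | x ⋄ 𝟘 | x ⋄ 𝟙
--        𝟘   |   𝟘   |   𝟘
--        𝟙   |   𝟙   |   𝟙
--        i   |   𝟘   |   𝟙
--        i*  |   𝟙   |   𝟘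
--
-- The table follows from three multiplication laws proved first (𝟘 and 𝟙 are
-- left-absorbing, i* acts on the left as complement); since 𝟘 ≢ 𝟙, any two rows
-- differ in some column, which gives the six required inequalities.

open import Defs
open import Level using (Level)
open import Relation.Binary.PropositionalEquality
open import Data.Product using (_,_)

module CMVLaws {a : Level} (C : CMVAlgebra a) where
  open CMVAlgebra C
  open IsMVAlgebra isMV using (*-involutive)

  -- 𝟙 = 𝟘* is left-absorbing, as the complement of the left-absorbing 𝟘.
  𝟙-⋄ : ∀ x → 𝟙 ⋄ x ≡ 𝟙
  𝟙-⋄ x = begin
    (𝟘 *) ⋄ x   ≡⟨ *-⋄ 𝟘 x ⟩
    (𝟘 ⋄ x) *   ≡⟨ cong _* (𝟘-⋄ x) ⟩
    𝟘 *         ∎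
    where open ≡-Reasoning

  i*-⋄ : ∀ x → (i *) ⋄ x ≡ x *
  i*-⋄ x = trans (*-⋄ i x) (cong _* (⋄-identityˡ x))

  𝟙* : 𝟙 * ≡ 𝟘
  𝟙* = *-involutive 𝟘

  separatedBy : ∀ c {x y u v} → x ⋄ c ≡ u → y ⋄ c ≡ v → u ≢ v → x ≢ y
  separatedBy c {x} {y} xc yc u≢v x≡y =
    u≢v (trans (sym xc) (trans (cong (_⋄ c) x≡y) yc))

mainTheorem2 : {a : Level} (C : CMVAlgebra a) → NonTrivial C → AtLeastFourElements (CMVAlgebra.Carrier C)
mainTheorem2 C 𝟘≢𝟙 =
  𝟘 , 𝟙 , i , i * ,
  𝟘≢𝟙 ,
  separatedBy 𝟙 (𝟘-⋄ 𝟙)  (⋄-identityˡ 𝟙) 𝟘≢𝟙 ,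
  separatedBy 𝟘 (𝟘-⋄ 𝟘)  (i*-⋄ 𝟘)        𝟘≢𝟙 ,
  separatedBy 𝟘 (𝟙-⋄ 𝟘)  (⋄-identityˡ 𝟘) 𝟙≢𝟘 ,
  separatedBy 𝟙 (𝟙-⋄ 𝟙)  (trans (i*-⋄ 𝟙) 𝟙*) 𝟙≢𝟘 ,
  separatedBy 𝟘 (⋄-identityˡ 𝟘) (i*-⋄ 𝟘) 𝟘≢𝟙
  where
  open CMVAlgebra C
  open CMVLaws C

  𝟙≢𝟘 : 𝟙 ≢ 𝟘
  𝟙≢𝟘 = ≢-sym 𝟘≢𝟙
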